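{- Let $\mathbf{u}$ be an infinite or finite word over a finite alphabet $\mathcal{A}$ satisfying: (1) every complete return word to a $\Theta$-palindromic factor of $\mathbf{u}$ is a $\Theta$-palindrome; (2) for every $a\in\mathcal{A}$ with $a\neq\Theta(a)$, the occurrences of $a$ and $\Theta(a)$ in $\mathbf{u}$ alternate; (3) every factor of $\mathbf{u}$ beginning with a letter $a\in\mathcal{A}$, ending with $\Theta(a)$, and containing no other occurrences of $a$ or $\Theta(a)$, is a $\Theta$-palindrome. Then $\mathbf{u}$ is $\Theta$-rich.
   Context: $\Theta$ is an involutory antimorphism of $\mathcal{A}^*$ ($\Theta^2=\mathrm{id}$, $\Theta(vw)=\Theta(w)\Theta(v)$); a word $v$ is a $\Theta$-palindrome if $\Theta(v)=v$. A complete return word to a factor $w$ is a factor of $\mathbf{u}$ containing exactly two occurrences of $w$, one as a prefix and one as a suffix. For a finite word $w$, $\gamma(w)=\{\{a,\Theta(a)\}: a\in\mathcal{A},\ a\neq\Theta(a),\ a\text{ or }\Theta(a)\text{ occurs in } w\}$. A finite word $w$ is $\Theta$-rich if it has exactly $|w|+1-\#\gamma(w)$ distinct $\Theta$-palindromic factors (empty word included); an infinite word is $\Theta$-rich if all its finite factors are. Occurrences of $a$ and $\Theta(a)$ alternate if there is no factor of length at least $2$ beginning and ending with $a$ and not containing $\Theta(a)$, and likewise with $a,\Theta(a)$ exchanged. -}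

module Defs where

open import Data.Nat using (ℕ; suc; _+_; _∸_; _<_; _<?_)
open import Data.Fin using (Fin; toℕ)
import Data.Fin.Properties as FinP
open import Data.List using (List; []; _∷_; _++_; [_]; length; map; filter; concatMap; inits; tails; take; deduplicate; upTo; allFin; cartesianProduct)
open import Data.List.Properties using (≡-dec)
open import Data.List.Membership.Propositional using (_∈_)
import Data.List.Relation.Unary.Any
open import Data.Product using (Σ; ∃; ∃-syntax; _×_; _,_; proj₁; proj₂)
open import Data.Sum using (_⊎_)
open import Relation.Binary.PropositionalEquality using (_≡_; _≢_)
open import Relation.Nullary using (¬_; Dec)
open import Relation.Nullary.Decidable using (_×-dec_; _⊎-dec_)
open import Relation.Binary using (DecidableEquality)

Word : ℕ → Set
Word k = List (Fin k)

_≟w_ : ∀ {k} → DecidableEquality (Word k)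
_≟w_ = ≡-dec FinP._≟_

record InvAntimorphism (k : ℕ) : Set where
  field
    Θ       : Word k → Word k
    invol   : ∀ w → Θ (Θ w) ≡ w
    antimor : ∀ v w → Θ (v ++ w) ≡ Θ w ++ Θ v

module _ {k : ℕ} (T : InvAntimorphism k) where
  open InvAntimorphism T

  IsPal : Word k → Set
  IsPal v = Θ v ≡ v

  isPal? : (v : Word k) → Dec (IsPal v)
  isPal? v = Θ v ≟w v

  factors : Word k → List (Word k)
  factors w = concatMap inits (tails w)

  -- number of distinct Θ-palindromic factors (empty word included)
  numPal : Word k → ℕ
  numPal w = length (deduplicate _≟w_ (filter isPal? (factors w)))

  occursIn? : (a : Fin k) (w : Word k) → Dec (a ∈ w)
  occursIn? a w = Data.List.Relation.Unary.Any.any? (FinP._≟_ a) w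

  -- γ(w): unordered pairs {a, Θ(a)} with a ≠ Θ(a) and a or Θ(a) occurring in w.
  -- Each such pair is listed once as the ordered pair (a , b) with Θ(a) = b and a < b.
  γ : Word k → List (Fin k × Fin k)
  γ w = filter (λ { (a , b) → ((toℕ a <? toℕ b) ×-dec (Θ [ a ] ≟w [ b ]))
                                ×-dec (occursIn? a w ⊎-dec occursIn? b w) })
               (cartesianProduct (allFin k) (allFin k))

  Rich : Word k → Set
  Rich w = numPal w ≡ suc (length w) ∸ length (γ w)

  FactorOf : Word k → Word k → Set
  FactorOf v f = Σ (Word k) λ p → Σ (Word k) λ s → f ≡ p ++ v ++ s

  occ : Word k → Word k → ℕ
  occ v r = length (filter (λ t → take (length v) t ≟w v) (tails r))

  -- r is a complete return word to v (in the abstract; factor-hood is required separately)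
  CompleteReturn : Word k → Word k → Set
  CompleteReturn v r = (Σ (Word k) λ s → r ≡ v ++ s)
                     × (Σ (Word k) λ p → r ≡ p ++ v)
                     × occ v r ≡ 2

data InfOrFin (k : ℕ) : Set where
  finite   : Word k → InfOrFin k
  infinite : (ℕ → Fin k) → InfOrFin k

Factor : ∀ {k} → InfOrFin k → Word k → Set
Factor (finite u) w = Σ (Word _) λ p → Σ (Word _) λ s → u ≡ p ++ w ++ s
Factor (infinite u) w = Σ ℕ λ i → w ≡ map (λ j → u (i + j)) (upTo (length w))

module _ {k : ℕ} (T : InvAntimorphism k) where
  open InvAntimorphism T

  Cond1 : InfOrFin k → Set
  Cond1 u = ∀ (w r : Word k) → w ≢ [] → Factor u w → IsPal T w →
            Factor u r → CompleteReturn T w r → IsPal T r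

  Cond2 : InfOrFin k → Set
  Cond2 u = ∀ (a : Fin k) → Θ [ a ] ≢ [ a ] →
            (∀ (m : Word k) → Factor u (a ∷ m ++ [ a ]) → FactorOf T (Θ [ a ]) (a ∷ m ++ [ a ]))
          × (∀ (m : Word k) → Factor u (Θ [ a ] ++ m ++ Θ [ a ]) → FactorOf T [ a ] (Θ [ a ] ++ m ++ Θ [ a ]))

  Cond3 : InfOrFin k → Set
  Cond3 u = ∀ (a : Fin k) (m : Word k) → Factor u (a ∷ m ++ Θ [ a ]) →
            ¬ FactorOf T [ a ] m → ¬ FactorOf T (Θ [ a ]) m →
            IsPal T (a ∷ m ++ Θ [ a ])

  RichWord : InfOrFin k → Set
  RichWord (finite u) = Rich T u
  RichWord (infinite u) = ∀ w → Factor (infinite u) w → Rich T w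

-- Induction on factors w of u, adding one letter x on the left, keeping
-- #Pal(w) + #γ(w) = |w| + 1. A new Θ-palindromic factor of xw must be a prefix of xw.
-- If neither x nor θ x occurs in w and θ x ≠ x, then xw has no nonempty palindromic
-- prefix, and γ gains the class {x, θ x}. Otherwise γ is unchanged, and the longest
-- palindromic prefix s of xw is the only new palindrome: it is nonempty (if θ x ≠ x,
-- cut xw at the first occurrence of x or θ x in w and use (2) and (3)); a later
-- occurrence of s in xw would end a complete return word to s which is a prefix of xw,
-- a palindrome by (1) and longer than s; and every shorter palindromic prefix of xw is
-- a suffix of the palindrome s, hence a factor of w.
module Submission where

open import Data.Empty using (⊥-elim)
open import Data.Fin using (Fin; toℕ)
import Data.Fin.Properties as Fin
open import Data.List
  using (List; []; _∷_; _++_; [_]; length; map; upTo; applyUpTo; filter; take; drop; inits; deduplicate;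
         cartesianProduct; allFin)
open import Data.List.Properties
  using (∷-injectiveˡ; ∷-injectiveʳ; ++-assoc; ++-identityʳ; ++-identityʳ-unique; ++-conicalʳ;
         length-++; length-take; ≡-dec; filter-accept; filter-reject; take++drop≡id; filter-++; filter-none; map-applyUpTo)
open import Data.List.Membership.Propositional using (_∈_; _∉_)
open import Data.List.Membership.Propositional.Properties
  using (∈-++⁺ˡ; ∈-++⁺ʳ; ∈-++⁻; ∈-map⁺; ∈-map⁻; ∈-filter⁺; ∈-filter⁻; ∈-deduplicate⁺; ∈-deduplicate⁻;
         ∈-cartesianProduct⁺; ∈-allFin)
open import Data.List.Membership.Propositional.Properties.WithK using (unique∧set⇒bag)
open import Data.List.Relation.Binary.BagAndSetEquality using (_∼[_]_; set; ∼bag⇒↭)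
open import Data.List.Relation.Binary.Permutation.Propositional.Properties using (↭-length)
open import Data.List.Relation.Unary.All as All using (All; []; _∷_)
open import Data.List.Relation.Unary.AllPairs using (_∷_)
open import Data.List.Relation.Unary.All.Properties using (¬Any⇒All¬; All¬⇒¬Any)
open import Data.List.Relation.Unary.Any as Any using (here; there)
import Data.List.Relation.Unary.First as First
open import Data.List.Relation.Unary.First.Properties using (toView)
open import Data.List.Relation.Unary.Unique.Propositional using (Unique)
open import Data.List.Relation.Unary.Unique.Propositional.Properties using (filter⁺; cartesianProduct⁺; allFin⁺)
import Data.List.Relation.Unary.Unique.DecPropositional.Properties as UniqueDec
open import Data.Nat using (ℕ; zero; suc; _+_; _∸_; _<_; _≤_; z≤n; s≤s)
open import Data.Nat.Properties
  using (≤-trans; ≤-reflexive; <-irrefl; <-asym; <-trans; n<1+n; <⇒≤; <⇒≱; m≤n⇒m<n∨m≡n; m⊓n≤m; m≤m+n; m≤n+m;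
         +-suc; +-assoc; m+n∸n≡m)
open import Data.Product using (∃; ∃₂; _×_; _,_; proj₁; proj₂)
open import Data.Sum as Sum using (_⊎_; inj₁; inj₂)
open import Function using (_∘_; id; _⇔_; mk⇔; Equivalence)
open import Relation.Binary using (DecidableEquality; tri<; tri≈; tri>)
open import Relation.Binary.PropositionalEquality
  using (_≡_; _≢_; refl; sym; trans; cong; cong₂; subst; module ≡-Reasoning)
open import Relation.Nullary using (¬_; Dec; yes; no)
open import Relation.Nullary.Decidable using (toSum; _⊎-dec_)

open import Defs

module _ {a} {A : Set a} where

  unique∧set⇒length≡ : {xs ys : List A} → Unique xs → Unique ys → xs ∼[ set ] ys → length xs ≡ length ys
  unique∧set⇒length≡ xs! ys! xs≈ys = ↭-length (∼bag⇒↭ (unique∧set⇒bag xs! ys! xs≈ys))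

  length-deduplicate : (_≟_ : DecidableEquality A) {xs ys : List A} →
                       Unique ys → xs ∼[ set ] ys → length (deduplicate _≟_ xs) ≡ length ys
  length-deduplicate _≟_ {xs} ys! xs≈ys = unique∧set⇒length≡ (UniqueDec.deduplicate-! _≟_ xs) ys!
    (mk⇔ (Equivalence.to xs≈ys ∘ ∈-deduplicate⁻ _≟_ xs) (∈-deduplicate⁺ _≟_ ∘ Equivalence.from xs≈ys))

  Unique-∷ : ∀ {x} {xs : List A} → x ∉ xs → Unique xs → Unique (x ∷ xs)
  Unique-∷ {xs = xs} x∉xs xs! = ¬Any⇒All¬ xs x∉xs ∷ xs!

  [_]≢++ : ∀ x {xs ys : List A} → xs ≢ [] → ys ≢ [] → [ x ] ≢ xs ++ ys
  [ x ]≢++ {[]}    xs≢[] _     _  = xs≢[] refl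
  [ x ]≢++ {_ ∷ xs} _    ys≢[] eq = ys≢[] (++-conicalʳ xs _ (sym (∷-injectiveʳ eq)))

least-witness : ∀ {p} {P : ℕ → Set p} → (∀ n → Dec (P n)) → ∀ {n} → P n →
                ∃ λ m → P m × (∀ j → j < m → ¬ P j)
least-witness P? {zero}  pn = zero , pn , λ _ ()
least-witness P? {suc n} pn with P? zero
... | yes p0 = zero , p0 , λ _ ()
... | no ¬p0 with least-witness (P? ∘ suc) pn
...   | m , pm , below = suc m , pm , λ { zero _ → ¬p0 ; (suc j) (s≤s j<m) → below j j<m }

module _ {a} {A : Set a} where

  Prefix : List A → List A → Set a
  Prefix p w = ∃ λ r → w ≡ p ++ r

  Prefix-refl : (w : List A) → Prefix w w
  Prefix-refl w = [] , sym (++-identityʳ w)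

  Prefix-trans : ∀ {p q w : List A} → Prefix p q → Prefix q w → Prefix p w
  Prefix-trans {p} (r , refl) (s , refl) = r ++ s , ++-assoc p r s

  Prefix-length : ∀ {p w : List A} → Prefix p w → length p ≤ length w
  Prefix-length {p} (r , refl) = ≤-trans (m≤m+n (length p) (length r)) (≤-reflexive (sym (length-++ p)))

  Prefix-take : ∀ {p w : List A} → Prefix p w → take (length p) w ≡ p
  Prefix-take {[]}    _          = refl
  Prefix-take {x ∷ p} (r , refl) = cong (x ∷_) (Prefix-take (r , refl))

  Prefix-of-take : ∀ {p w : List A} n → Prefix p w → length p ≤ n → Prefix p (take n w)
  Prefix-of-take {[]}    n       _          _         = take n _ , refl
  Prefix-of-take {x ∷ p} (suc n) (r , refl) (s≤s p≤n) =
    let (r′ , eq) = Prefix-of-take n (r , refl) p≤n in r′ , cong (x ∷_) eq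

  Prefix-shorter : ∀ {p q w : List A} → Prefix p w → Prefix q w → length p ≤ length q → Prefix p q
  Prefix-shorter p⊑w q⊑w |p|≤|q| = subst (Prefix _) (Prefix-take q⊑w) (Prefix-of-take _ p⊑w |p|≤|q|)

  take-length⇒Prefix : ∀ {p w : List A} → take (length p) w ≡ p → Prefix p w
  take-length⇒Prefix {p} {w} eq = drop (length p) w , trans (sym (take++drop≡id (length p) w)) (cong (_++ drop (length p) w) eq)

  prefix? : DecidableEquality A → ∀ p w → Dec (Prefix p w)
  prefix? _≟_ p w with ≡-dec _≟_ (take (length p) w) p
  ... | yes eq = yes (take-length⇒Prefix eq)
  ... | no neq = no (neq ∘ Prefix-take)

  Prefix-drop-++ : ∀ j (xs ys : List A) → Prefix (drop j xs) (drop j (xs ++ ys))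
  Prefix-drop-++ zero    xs       ys = ys , refl
  Prefix-drop-++ (suc j) []       ys = drop (suc j) ys , refl
  Prefix-drop-++ (suc j) (x ∷ xs) ys = Prefix-drop-++ j xs ys

  drop-length-++ : ∀ (p w : List A) → drop (length p) (p ++ w) ≡ w
  drop-length-++ []      w = refl
  drop-length-++ (x ∷ p) w = drop-length-++ p w

  ∈-inits⁻ : ∀ {p} (w : List A) → p ∈ inits w → Prefix p w
  ∈-inits⁻ w       (here refl) = w , refl
  ∈-inits⁻ (x ∷ w) (there p∈) with ∈-map⁻ (x ∷_) p∈
  ... | p , p∈′ , refl = let (r , eq) = ∈-inits⁻ w p∈′ in r , cong (x ∷_) eq

  ∈-inits⁺ : ∀ {p w : List A} → Prefix p w → p ∈ inits w
  ∈-inits⁺ {[]}    _          = here refl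
  ∈-inits⁺ {x ∷ p} (r , refl) = there (∈-map⁺ (x ∷_) (∈-inits⁺ (r , refl)))

module LongestPrefix {a p} {A : Set a} {P : List A → Set p} (P? : ∀ v → Dec (P v)) (P[] : P []) where

  longestUpTo : ℕ → List A → List A
  longestUpTo zero    w = []
  longestUpTo (suc n) w with P? (take (suc n) w)
  ... | yes _ = take (suc n) w
  ... | no  _ = longestUpTo n w

  longestUpTo-satisfies : ∀ n w → P (longestUpTo n w)
  longestUpTo-satisfies zero    w = P[]
  longestUpTo-satisfies (suc n) w with P? (take (suc n) w)
  ... | yes pw = pw
  ... | no  _  = longestUpTo-satisfies n w

  longestUpTo-prefix : ∀ n w → Prefix (longestUpTo n w) w
  longestUpTo-prefix zero    w = w , refl
  longestUpTo-prefix (suc n) w with P? (take (suc n) w)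
  ... | yes _ = drop (suc n) w , sym (take++drop≡id (suc n) w)
  ... | no  _ = longestUpTo-prefix n w

  longestUpTo-maximal : ∀ n {v w} → Prefix v w → P v → length v ≤ n → length v ≤ length (longestUpTo n w)
  longestUpTo-maximal zero    _   _  v≤n = v≤n
  longestUpTo-maximal (suc n) {v} {w} v⊑w pv v≤n with P? (take (suc n) w)
  ... | yes _  = Prefix-length (Prefix-of-take (suc n) v⊑w v≤n)
  ... | no ¬pw with m≤n⇒m<n∨m≡n v≤n
  ...   | inj₁ (s≤s v≤n′) = longestUpTo-maximal n v⊑w pv v≤n′
  ...   | inj₂ |v|≡1+n     = ⊥-elim (¬pw (subst (λ m → P (take m w)) |v|≡1+n (subst P (sym (Prefix-take v⊑w)) pv)))

  longest : List A → List A
  longest w = longestUpTo (length w) w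

  longest-satisfies : ∀ w → P (longest w)
  longest-satisfies w = longestUpTo-satisfies (length w) w

  longest-prefix : ∀ w → Prefix (longest w) w
  longest-prefix w = longestUpTo-prefix (length w) w

  longest-maximal : ∀ {v w} → Prefix v w → P v → length v ≤ length (longest w)
  longest-maximal v⊑w pv = longestUpTo-maximal _ v⊑w pv (Prefix-length v⊑w)

module _ {k : ℕ} (T : InvAntimorphism k) where
  open InvAntimorphism T

  Θ-[] : Θ [] ≡ []
  Θ-[] = ++-identityʳ-unique (Θ []) (antimor [] [])

  Θ-≢[] : ∀ {w} → w ≢ [] → Θ w ≢ []
  Θ-≢[] {w} w≢[] Θw≡[] = w≢[] (trans (sym (invol w)) (trans (cong Θ Θw≡[]) Θ-[]))

  Θ-letter : ∀ a → ∃ λ b → Θ [ a ] ≡ [ b ]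
  Θ-letter a with Θ [ a ] in eq
  ... | []        = ⊥-elim (Θ-≢[] (λ ()) eq)
  ... | b ∷ []    = b , refl
  ... | b ∷ c ∷ l = ⊥-elim ([ a ]≢++ (Θ-≢[] (λ ())) (Θ-≢[] (λ ())) [a]≡)
    where
    [a]≡ : [ a ] ≡ Θ (c ∷ l) ++ Θ [ b ]
    [a]≡ = trans (sym (invol [ a ])) (trans (cong Θ eq) (antimor [ b ] (c ∷ l)))

  θ : Fin k → Fin k
  θ a = proj₁ (Θ-letter a)

  Θ-singleton : ∀ a → Θ [ a ] ≡ [ θ a ]
  Θ-singleton a = proj₂ (Θ-letter a)

  θ-involutive : ∀ a → θ (θ a) ≡ a
  θ-involutive a = ∷-injectiveˡ (begin
    [ θ (θ a) ]   ≡⟨ sym (Θ-singleton (θ a)) ⟩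
    Θ [ θ a ]     ≡⟨ cong Θ (sym (Θ-singleton a)) ⟩
    Θ (Θ [ a ])   ≡⟨ invol [ a ] ⟩
    [ a ]         ∎)
    where open ≡-Reasoning

  Θ-∷ : ∀ a w → Θ (a ∷ w) ≡ Θ w ++ [ θ a ]
  Θ-∷ a w = trans (antimor [ a ] w) (cong (Θ w ++_) (Θ-singleton a))

  IsPal-prefix⇒suffix : ∀ {s p t} → IsPal T s → IsPal T p → s ≡ p ++ t → s ≡ Θ t ++ p
  IsPal-prefix⇒suffix {s} {p} {t} pal-s pal-p s≡ = begin
    s             ≡⟨ sym pal-s ⟩
    Θ s           ≡⟨ cong Θ s≡ ⟩
    Θ (p ++ t)    ≡⟨ antimor p t ⟩
    Θ t ++ Θ p    ≡⟨ cong (Θ t ++_) pal-p ⟩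
    Θ t ++ p      ∎
    where open ≡-Reasoning

  ∈-factors⁺ : ∀ {v} w → FactorOf T v w → v ∈ factors T w
  ∈-factors⁺ w       ([]    , s , eq)   = ∈-++⁺ˡ (∈-inits⁺ (s , eq))
  ∈-factors⁺ (x ∷ w) (_ ∷ p , s , refl) = ∈-++⁺ʳ (inits (x ∷ w)) (∈-factors⁺ w (p , s , refl))

  ∈-factors⁻ : ∀ {v} w → v ∈ factors T w → FactorOf T v w
  ∈-factors⁻ []      (here refl) = [] , [] , refl
  ∈-factors⁻ (x ∷ w) v∈ with ∈-++⁻ (inits (x ∷ w)) v∈
  ... | inj₁ v∈inits   = let (r , eq) = ∈-inits⁻ (x ∷ w) v∈inits in [] , r , eq
  ... | inj₂ v∈factors = let (p , s , eq) = ∈-factors⁻ w v∈factors in x ∷ p , s , cong (x ∷_) eq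

  FactorOf-singleton⇒∈ : ∀ {b w} → FactorOf T [ b ] w → b ∈ w
  FactorOf-singleton⇒∈ (p , _ , refl) = ∈-++⁺ʳ p (here refl)

  occ-∷-prefix : ∀ {v c r} → Prefix v (c ∷ r) → occ T v (c ∷ r) ≡ suc (occ T v r)
  occ-∷-prefix {v} v⊑ = cong length (filter-accept (λ t → take (length v) t ≟w v) (Prefix-take v⊑))

  occ-∷-¬prefix : ∀ {v c r} → ¬ Prefix v (c ∷ r) → occ T v (c ∷ r) ≡ occ T v r
  occ-∷-¬prefix {v} ¬v⊑ = cong length (filter-reject (λ t → take (length v) t ≟w v) (¬v⊑ ∘ take-length⇒Prefix))

  occ-short : ∀ {v} r → length r < length v → occ T v r ≡ 0
  occ-short {v} []      r<v = cong length (filter-reject (λ t → take (length v) t ≟w v)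
                                                         (<⇒≱ r<v ∘ Prefix-length ∘ take-length⇒Prefix {w = []}))
  occ-short {v} (c ∷ r) r<v =
    trans (occ-∷-¬prefix {v} (<⇒≱ r<v ∘ Prefix-length)) (occ-short {v} r (<-trans (n<1+n _) r<v))

  occ-only-suffix : ∀ {v} p → v ≢ [] → (∀ j → j < length p → ¬ Prefix v (drop j (p ++ v))) → occ T v (p ++ v) ≡ 1
  occ-only-suffix {[]}    _       v≢[] _     = ⊥-elim (v≢[] refl)
  occ-only-suffix {c ∷ v} []      _    _     =
    trans (occ-∷-prefix (Prefix-refl (c ∷ v))) (cong suc (occ-short {c ∷ v} v (n<1+n _)))
  occ-only-suffix {v}     (_ ∷ p) v≢[] later =
    trans (occ-∷-¬prefix {v} (later 0 (s≤s z≤n))) (occ-only-suffix {v} p v≢[] (λ j j<p → later (suc j) (s≤s j<p)))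

  -- r ends at the leftmost occurrence of s after position 0.
  complete-return-prefix : ∀ {s w} → s ≢ [] → Prefix s w → ∀ i → Prefix s (drop (suc i) w) →
                           ∃ λ r → Prefix r w × CompleteReturn T s r × length s < length r
  complete-return-prefix {[]}            s≢[] _          = ⊥-elim (s≢[] refl)
  complete-return-prefix {_ ∷ _} {[]}    _    (_ , ())
  complete-return-prefix {s}     {c ∷ w} s≢[] s⊑c∷w i later
    with least-witness (λ j → prefix? Fin._≟_ s (drop j w)) {i} later
  ... | m , (q , drop-m≡) , before = r , r⊑c∷w , (s⊑r , (c ∷ p , refl) , occ-r) , |s|<|r|
    where
    p r : Word k
    p = take m w
    r = c ∷ p ++ s
    w≡ : w ≡ (p ++ s) ++ q
    w≡ = trans (sym (take++drop≡id m w)) (trans (cong (p ++_) drop-m≡) (sym (++-assoc p s q)))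
    r⊑c∷w : Prefix r (c ∷ w)
    r⊑c∷w = q , cong (c ∷_) w≡
    |s|<|r| : length s < length r
    |s|<|r| = s≤s (≤-trans (m≤n+m (length s) (length p)) (≤-reflexive (sym (length-++ p))))
    s⊑r : Prefix s r
    s⊑r = Prefix-shorter s⊑c∷w r⊑c∷w (<⇒≤ |s|<|r|)
    |p|≤m : length p ≤ m
    |p|≤m = ≤-trans (≤-reflexive (length-take m w)) (m⊓n≤m m (length w))
    no-inner : ∀ j → j < length p → ¬ Prefix s (drop j (p ++ s))
    no-inner j j<p s⊑ = before j (≤-trans j<p |p|≤m)
      (Prefix-trans s⊑ (subst (Prefix _) (sym (cong (drop j) w≡)) (Prefix-drop-++ j (p ++ s) q)))
    occ-r : occ T s r ≡ 2
    occ-r = trans (occ-∷-prefix {s} s⊑r) (cong suc (occ-only-suffix {s} p s≢[] no-inner))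

  open LongestPrefix (isPal? T) Θ-[] public
    using () renaming (longest to longestPal; longest-satisfies to longestPal-isPal;
                       longest-prefix to longestPal-prefix; longest-maximal to longestPal-maximal)

  pal-prefix-fresh : ∀ {x w p} → θ x ≢ x → θ x ∉ w → Prefix p (x ∷ w) → IsPal T p → p ≡ []
  pal-prefix-fresh {p = []}    _    _    _          _   = refl
  pal-prefix-fresh {x} {p = _ ∷ p} θx≢x θx∉w (r , refl) pal
    with subst (θ x ∈_) (trans (sym (Θ-∷ x p)) pal) (∈-++⁺ʳ (Θ p) (here refl))
  ... | here θx≡x = ⊥-elim (θx≢x θx≡x)
  ... | there θx∈p = ⊥-elim (θx∉w (∈-++⁺ˡ θx∈p))

  pal-prefix-factor-or-longestPal : ∀ {x w p} → Prefix p (x ∷ w) → IsPal T p → FactorOf T p w ⊎ p ≡ longestPal (x ∷ w)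
  pal-prefix-factor-or-longestPal {x} {w} {p} p⊑ pal-p
    with longestPal-prefix (x ∷ w) | m≤n⇒m<n∨m≡n (longestPal-maximal p⊑ pal-p)
  ... | s⊑ | inj₂ |p|≡|s| =
    inj₂ (trans (sym (Prefix-take p⊑)) (trans (cong (λ n → take n (x ∷ w)) |p|≡|s|) (Prefix-take s⊑)))
  ... | s⊑@(sr , x∷w≡s++sr) | inj₁ |p|<|s| with Prefix-shorter p⊑ s⊑ (<⇒≤ |p|<|s|)
  ...   | t , s≡p++t with Θ t in Θt≡
  ...     | []     = ⊥-elim (Θ-≢[] t≢[] Θt≡)
    where
    t≢[] : t ≢ []
    t≢[] t≡[] = <-irrefl (sym (cong length (trans s≡p++t (trans (cong (p ++_) t≡[]) (++-identityʳ p))))) |p|<|s|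
  ...     | c ∷ t′ = inj₁ (t′ , sr , ∷-injectiveʳ x∷w≡)
    where
    x∷w≡ : x ∷ w ≡ c ∷ t′ ++ p ++ sr
    x∷w≡ = begin
      x ∷ w               ≡⟨ x∷w≡s++sr ⟩
      longestPal (x ∷ w) ++ sr
        ≡⟨ cong (_++ sr) (IsPal-prefix⇒suffix (longestPal-isPal (x ∷ w)) pal-p s≡p++t) ⟩
      (Θ t ++ p) ++ sr    ≡⟨ cong (λ z → (z ++ p) ++ sr) Θt≡ ⟩
      (c ∷ t′ ++ p) ++ sr ≡⟨ cong (c ∷_) (++-assoc t′ p sr) ⟩
      c ∷ t′ ++ p ++ sr   ∎
      where open ≡-Reasoning

  palPrefixes palFactors : Word k → List (Word k)
  palPrefixes w = filter (isPal? T) (inits w)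
  palFactors  w = filter (isPal? T) (factors T w)

  ∈-palFactors⁺ : ∀ {v} w → FactorOf T v w → IsPal T v → v ∈ palFactors w
  ∈-palFactors⁺ w v⊑w pal = ∈-filter⁺ (isPal? T) (∈-factors⁺ w v⊑w) pal

  ∈-palFactors⁻ : ∀ {v} w → v ∈ palFactors w → FactorOf T v w
  ∈-palFactors⁻ w v∈ = ∈-factors⁻ w (proj₁ (∈-filter⁻ (isPal? T) v∈))

  ∈-palPrefixes⁻ : ∀ {v} w → v ∈ palPrefixes w → Prefix v w × IsPal T v
  ∈-palPrefixes⁻ w v∈ = let (v∈inits , pal) = ∈-filter⁻ (isPal? T) v∈ in ∈-inits⁻ w v∈inits , pal

  numPal-∷ : ∀ x w → numPal T (x ∷ w) ≡ length (deduplicate _≟w_ (palPrefixes (x ∷ w) ++ palFactors w))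
  numPal-∷ x w = cong (length ∘ deduplicate _≟w_) (filter-++ (isPal? T) (inits (x ∷ w)) (factors T w))

  numPal-∷-≡ : ∀ {x w} → (∀ {p} → Prefix p (x ∷ w) → IsPal T p → FactorOf T p w) → numPal T (x ∷ w) ≡ numPal T w
  numPal-∷-≡ {x} {w} prefix⇒factor =
    trans (numPal-∷ x w) (length-deduplicate _≟w_ (UniqueDec.deduplicate-! _≟w_ B) (mk⇔ to from))
    where
    A B : List (Word k)
    A = palPrefixes (x ∷ w)
    B = palFactors w
    A⊆B : ∀ {v} → v ∈ A → v ∈ B
    A⊆B v∈ = let (v⊑ , pal) = ∈-palPrefixes⁻ (x ∷ w) v∈ in ∈-palFactors⁺ w (prefix⇒factor v⊑ pal) pal
    to : ∀ {v} → v ∈ A ++ B → v ∈ deduplicate _≟w_ B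
    to v∈ = ∈-deduplicate⁺ _≟w_ (Sum.[ A⊆B , id ] (∈-++⁻ A v∈))
    from : ∀ {v} → v ∈ deduplicate _≟w_ B → v ∈ A ++ B
    from = ∈-++⁺ʳ A ∘ ∈-deduplicate⁻ _≟w_ B

  numPal-∷-suc : ∀ {x w s} → Prefix s (x ∷ w) → IsPal T s → ¬ FactorOf T s w →
                 (∀ {p} → Prefix p (x ∷ w) → IsPal T p → FactorOf T p w ⊎ p ≡ s) →
                 numPal T (x ∷ w) ≡ suc (numPal T w)
  numPal-∷-suc {x} {w} {s} s⊑ pal-s ¬s⊑w classify =
    trans (numPal-∷ x w) (length-deduplicate _≟w_ (Unique-∷ s∉ (UniqueDec.deduplicate-! _≟w_ B)) (mk⇔ to from))
    where
    A B : List (Word k)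
    A = palPrefixes (x ∷ w)
    B = palFactors w
    s∉ : s ∉ deduplicate _≟w_ B
    s∉ = ¬s⊑w ∘ ∈-palFactors⁻ w ∘ ∈-deduplicate⁻ _≟w_ B
    fromA : ∀ {v} → v ∈ A → v ∈ s ∷ deduplicate _≟w_ B
    fromA v∈ with ∈-palPrefixes⁻ (x ∷ w) v∈
    ... | v⊑ , pal with classify v⊑ pal
    ...   | inj₁ v⊑w = there (∈-deduplicate⁺ _≟w_ (∈-palFactors⁺ w v⊑w pal))
    ...   | inj₂ v≡s = here v≡s
    to : ∀ {v} → v ∈ A ++ B → v ∈ s ∷ deduplicate _≟w_ B
    to v∈ = Sum.[ fromA , there ∘ ∈-deduplicate⁺ _≟w_ ] (∈-++⁻ A v∈)
    from : ∀ {v} → v ∈ s ∷ deduplicate _≟w_ B → v ∈ A ++ B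
    from (here refl) = ∈-++⁺ˡ (∈-filter⁺ (isPal? T) (∈-inits⁺ s⊑) pal-s)
    from (there v∈)  = ∈-++⁺ʳ A (∈-deduplicate⁻ _≟w_ B v∈)

  OrderedθPair : Fin k → Fin k → Set
  OrderedθPair a b = toℕ a < toℕ b × θ a ≡ b

  ∈-γ⁻ : ∀ {a b w} → (a , b) ∈ γ T w → OrderedθPair a b × (a ∈ w ⊎ b ∈ w)
  ∈-γ⁻ {a} ab∈ with ∈-filter⁻ _ {xs = cartesianProduct (allFin k) (allFin k)} ab∈
  ... | _ , (a<b , Θa≡b) , touch = (a<b , ∷-injectiveˡ (trans (sym (Θ-singleton a)) Θa≡b)) , touch

  ∈-γ⁺ : ∀ {a b w} → OrderedθPair a b → a ∈ w ⊎ b ∈ w → (a , b) ∈ γ T w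
  ∈-γ⁺ {a} (a<b , θa≡b) touch =
    ∈-filter⁺ _ (∈-cartesianProduct⁺ (∈-allFin _) (∈-allFin _)) ((a<b , trans (Θ-singleton a) (cong [_] θa≡b)) , touch)

  γ-unique : ∀ w → Unique (γ T w)
  γ-unique w = filter⁺ _ (cartesianProduct⁺ (allFin⁺ k) (allFin⁺ k))

  γ-∷⁺ : ∀ {a b x w} → (a , b) ∈ γ T w → (a , b) ∈ γ T (x ∷ w)
  γ-∷⁺ ab∈ = let (pair , touch) = ∈-γ⁻ ab∈ in ∈-γ⁺ pair (Sum.map there there touch)

  touch-∷ : ∀ {a b x : Fin k} {w} → a ∈ x ∷ w ⊎ b ∈ x ∷ w → (a ≡ x ⊎ b ≡ x) ⊎ (a ∈ w ⊎ b ∈ w)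
  touch-∷ (inj₁ (here a≡x))  = inj₁ (inj₁ a≡x)
  touch-∷ (inj₂ (here b≡x))  = inj₁ (inj₂ b≡x)
  touch-∷ (inj₁ (there a∈w)) = inj₂ (inj₁ a∈w)
  touch-∷ (inj₂ (there b∈w)) = inj₂ (inj₂ b∈w)

  θPair-letters : ∀ {a b x} → θ a ≡ b → a ≡ x ⊎ b ≡ x → (a ≡ x × b ≡ θ x) ⊎ (a ≡ θ x × b ≡ x)
  θPair-letters     θa≡b (inj₁ refl) = inj₁ (refl , sym θa≡b)
  θPair-letters {a} θa≡b (inj₂ refl) = inj₂ (trans (sym (θ-involutive a)) (cong θ θa≡b) , refl)

  touch-θPair : ∀ {a b x} {v : Word k} → (a ≡ x × b ≡ θ x) ⊎ (a ≡ θ x × b ≡ x) →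
                (a ∈ v ⊎ b ∈ v) ⇔ (x ∈ v ⊎ θ x ∈ v)
  touch-θPair (inj₁ (refl , refl)) = mk⇔ id id
  touch-θPair (inj₂ (refl , refl)) = mk⇔ Sum.swap Sum.swap

  θPair-of : ∀ x → θ x ≢ x → ∃₂ λ a b → OrderedθPair a b × (a ≡ x ⊎ b ≡ x)
  θPair-of x θx≢x with Fin.<-cmp x (θ x)
  ... | tri< x<θx _ _ = x , θ x , (x<θx , refl) , inj₁ refl
  ... | tri≈ _ x≡θx _ = ⊥-elim (θx≢x (sym x≡θx))
  ... | tri> _ _ θx<x = θ x , x , (θx<x , θ-involutive x) , inj₂ refl

  θPair-unique : ∀ {a b a′ b′ x} → OrderedθPair a b → OrderedθPair a′ b′ →
                 a ≡ x ⊎ b ≡ x → a′ ≡ x ⊎ b′ ≡ x → (a , b) ≡ (a′ , b′)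
  θPair-unique (a<b , θa≡b) (a′<b′ , θa′≡b′) at at′ with θPair-letters θa≡b at | θPair-letters θa′≡b′ at′
  ... | inj₁ (refl , refl) | inj₁ (refl , refl) = refl
  ... | inj₂ (refl , refl) | inj₂ (refl , refl) = refl
  ... | inj₁ (refl , refl) | inj₂ (refl , refl) = ⊥-elim (<-asym a<b a′<b′)
  ... | inj₂ (refl , refl) | inj₁ (refl , refl) = ⊥-elim (<-asym a<b a′<b′)

  Seen : Fin k → Word k → Set
  Seen x w = θ x ≡ x ⊎ x ∈ w ⊎ θ x ∈ w

  seen? : ∀ x w → Dec (Seen x w)
  seen? x w = (θ x Fin.≟ x) ⊎-dec (occursIn? T x w ⊎-dec occursIn? T (θ x) w)

  seen-touch : ∀ {a b x w} → Seen x w → OrderedθPair a b → a ≡ x ⊎ b ≡ x → a ∈ w ⊎ b ∈ w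
  seen-touch (inj₂ touch) (_ , θa≡b) at-x = Equivalence.from (touch-θPair (θPair-letters θa≡b at-x)) touch
  seen-touch (inj₁ θx≡x) (a<b , θa≡b) at-x with θPair-letters θa≡b at-x
  ... | inj₁ (refl , refl) = ⊥-elim (<-irrefl (cong toℕ (sym θx≡x)) a<b)
  ... | inj₂ (refl , refl) = ⊥-elim (<-irrefl (cong toℕ θx≡x) a<b)

  γ-∷-seen : ∀ {x w} → Seen x w → length (γ T (x ∷ w)) ≡ length (γ T w)
  γ-∷-seen {x} {w} seen = unique∧set⇒length≡ (γ-unique (x ∷ w)) (γ-unique w) (mk⇔ to γ-∷⁺)
    where
    to : ∀ {ab} → ab ∈ γ T (x ∷ w) → ab ∈ γ T w
    to {a , b} ab∈ = let (pair , touch) = ∈-γ⁻ ab∈ in ∈-γ⁺ pair (Sum.[ seen-touch seen pair , id ] (touch-∷ touch))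

  γ-∷-fresh : ∀ {x w} → ¬ Seen x w → length (γ T (x ∷ w)) ≡ suc (length (γ T w))
  γ-∷-fresh {x} {w} ¬seen with θPair-of x (¬seen ∘ inj₁)
  ... | a , b , pair , at-x = unique∧set⇒length≡ (γ-unique (x ∷ w)) (Unique-∷ ab∉ (γ-unique w)) (mk⇔ to from)
    where
    ab∉ : (a , b) ∉ γ T w
    ab∉ = ¬seen ∘ inj₂ ∘ Equivalence.to (touch-θPair (θPair-letters (proj₂ pair) at-x)) ∘ proj₂ ∘ ∈-γ⁻
    to : ∀ {cd} → cd ∈ γ T (x ∷ w) → cd ∈ (a , b) ∷ γ T w
    to {c , d} cd∈ = let (pair′ , touch) = ∈-γ⁻ cd∈ in
      Sum.[ (λ at-x′ → here (θPair-unique pair′ pair at-x′ at-x)) , there ∘ ∈-γ⁺ pair′ ] (touch-∷ touch)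
    from : ∀ {cd} → cd ∈ (a , b) ∷ γ T w → cd ∈ γ T (x ∷ w)
    from (here refl)  = ∈-γ⁺ pair (Sum.map here here at-x)
    from (there cd∈) = γ-∷⁺ cd∈

  numPal-∷-fresh : ∀ {x w} → ¬ Seen x w → numPal T (x ∷ w) ≡ numPal T w
  numPal-∷-fresh {x} {w} ¬seen = numPal-∷-≡ λ p⊑ pal →
    subst (λ p → FactorOf T p w) (sym (pal-prefix-fresh (¬seen ∘ inj₁) (¬seen ∘ inj₂ ∘ inj₂) p⊑ pal)) ([] , w , refl)

  -- Rich without the truncated subtraction.
  RichCount : Word k → Set
  RichCount w = numPal T w + length (γ T w) ≡ suc (length w)

  RichCount-[] : RichCount []
  RichCount-[] = cong₂ _+_ (cong (length ∘ deduplicate _≟w_) (filter-accept (isPal? T) {xs = []} Θ-[]))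
                           (cong length (filter-none _ {xs = cartesianProduct (allFin k) (allFin k)}
                                                       (All.tabulate λ _ → λ { (_ , inj₁ ()) ; (_ , inj₂ ()) })))

  RichCount⇒Rich : ∀ {w} → RichCount w → Rich T w
  RichCount⇒Rich {w} count = trans (sym (m+n∸n≡m (numPal T w) (length (γ T w)))) (cong (_∸ length (γ T w)) count)

module Richness {k : ℕ} (T : InvAntimorphism k) (u : InfOrFin k)
  (Factor-infix : ∀ p v s → Factor u (p ++ v ++ s) → Factor u v)
  (cond1 : Cond1 T u) (cond2 : Cond2 T u) (cond3 : Cond3 T u) where

  open InvAntimorphism T

  Factor-FactorOf : ∀ {v w} → Factor u w → FactorOf T v w → Factor u v
  Factor-FactorOf fw (p , s , refl) = Factor-infix p _ s fw

  Factor-prefix : ∀ {v w} → Factor u w → Prefix v w → Factor u v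
  Factor-prefix fw (r , w≡v++r) = Factor-FactorOf fw ([] , r , w≡v++r)

  NonemptyPalPrefix : Word k → Set
  NonemptyPalPrefix v = ∃ λ p → p ≢ [] × Prefix p v × IsPal T p

  x-return-contains-θx : ∀ {x m rest} → θ T x ≢ x → Factor u (x ∷ m ++ x ∷ rest) → θ T x ∈ m
  x-return-contains-θx {x} {m} {rest} θx≢x fx = θx∈ (FactorOf-singleton⇒∈ T θx⊑)
    where
    θx⊑ : FactorOf T [ θ T x ] (x ∷ m ++ [ x ])
    θx⊑ = subst (λ z → FactorOf T z (x ∷ m ++ [ x ])) (Θ-singleton T x)
            (proj₁ (cond2 x (θx≢x ∘ ∷-injectiveˡ ∘ trans (sym (Θ-singleton T x)))) m
                   (Factor-prefix fx (rest , cong (x ∷_) (sym (++-assoc m [ x ] rest)))))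
    θx∈ : θ T x ∈ x ∷ m ++ [ x ] → θ T x ∈ m
    θx∈ (here θx≡x) = ⊥-elim (θx≢x θx≡x)
    θx∈ (there θx∈) with ∈-++⁻ m θx∈
    ... | inj₁ θx∈m        = θx∈m
    ... | inj₂ (here θx≡x) = ⊥-elim (θx≢x θx≡x)

  θx-return-pal-prefix : ∀ {x m rest} → Factor u (x ∷ m ++ θ T x ∷ rest) → x ∉ m → θ T x ∉ m →
                         NonemptyPalPrefix (x ∷ m ++ θ T x ∷ rest)
  θx-return-pal-prefix {x} {m} {rest} fx x∉m θx∉m =
    x ∷ m ++ Θ [ x ] , (λ ()) , p⊑ , cond3 x m (Factor-prefix fx p⊑) (x∉m ∘ FactorOf-singleton⇒∈ T) θx⋢m
    where
    p⊑ : Prefix (x ∷ m ++ Θ [ x ]) (x ∷ m ++ θ T x ∷ rest)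
    p⊑ = rest , cong (x ∷_) (sym (trans (++-assoc m (Θ [ x ]) rest) (cong (λ z → m ++ z ++ rest) (Θ-singleton T x))))
    θx⋢m : ¬ FactorOf T (Θ [ x ]) m
    θx⋢m = θx∉m ∘ FactorOf-singleton⇒∈ T ∘ subst (λ z → FactorOf T z m) (Θ-singleton T x)

  seen⇒nonempty-pal-prefix : ∀ {x w} → Factor u (x ∷ w) → Seen T x w → NonemptyPalPrefix (x ∷ w)
  seen⇒nonempty-pal-prefix {x} {w} fx∷w seen with θ T x Fin.≟ x
  ... | yes θx≡x = [ x ] , (λ ()) , (w , refl) , trans (Θ-singleton T x) (cong [_] θx≡x)
  ... | no θx≢x with First.first (λ c → Sum.swap (toSum (D? c))) w
    where
    D? : ∀ c → Dec (c ≡ x ⊎ c ≡ θ T x)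
    D? c = (c Fin.≟ x) ⊎-dec (c Fin.≟ θ T x)
  ...   | inj₂ avoid =
    ⊥-elim (All¬⇒¬Any avoid (Sum.[ ⊥-elim ∘ θx≢x , Sum.[ Any.map (inj₁ ∘ sym) , Any.map (inj₂ ∘ sym) ] ] seen))
  ...   | inj₁ fst with toView fst
  ...     | First._++_∷_ {m} avoid (inj₂ refl) rest =
    θx-return-pal-prefix fx∷w (λ x∈m → All.lookup avoid x∈m (inj₁ refl)) (λ θx∈m → All.lookup avoid θx∈m (inj₂ refl))
  ...     | First._++_∷_ {m} avoid (inj₁ refl) rest =
    ⊥-elim (All.lookup avoid (x-return-contains-θx θx≢x fx∷w) (inj₂ refl))

  longestPal-nonempty : ∀ {x w} → Factor u (x ∷ w) → Seen T x w → longestPal T (x ∷ w) ≢ []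
  longestPal-nonempty fx∷w seen s≡[] with seen⇒nonempty-pal-prefix fx∷w seen
  ... | []    , p≢[] , _        = p≢[] refl
  ... | _ ∷ _ , _    , p⊑ , pal with subst (λ s → _ ≤ length s) s≡[] (longestPal-maximal T p⊑ pal)
  ...   | ()

  longestPal-not-factor : ∀ {x w} → Factor u (x ∷ w) → longestPal T (x ∷ w) ≢ [] →
                          ¬ FactorOf T (longestPal T (x ∷ w)) w
  longestPal-not-factor {x} {w} fx∷w s≢[] (p , q , w≡p++s++q)
    with complete-return-prefix T s≢[] (longestPal-prefix T (x ∷ w)) (length p)
                                (q , trans (cong (drop (length p)) w≡p++s++q) (drop-length-++ p _))
  ... | r , r⊑ , return , |s|<|r| =
    <⇒≱ |s|<|r| (longestPal-maximal T r⊑ (cond1 _ r s≢[] (Factor-prefix fx∷w (longestPal-prefix T (x ∷ w)))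
                                                (longestPal-isPal T (x ∷ w)) (Factor-prefix fx∷w r⊑) return))

  numPal-∷-seen : ∀ {x w} → Factor u (x ∷ w) → Seen T x w → numPal T (x ∷ w) ≡ suc (numPal T w)
  numPal-∷-seen fx∷w seen = numPal-∷-suc T (longestPal-prefix T _) (longestPal-isPal T _)
    (longestPal-not-factor fx∷w (longestPal-nonempty fx∷w seen)) (pal-prefix-factor-or-longestPal T)

  RichCount-∷ : ∀ {x w} → Factor u (x ∷ w) → RichCount T w → RichCount T (x ∷ w)
  RichCount-∷ {x} {w} fx∷w count with seen? T x w
  ... | yes seen = trans (cong₂ _+_ (numPal-∷-seen fx∷w seen) (γ-∷-seen T seen)) (cong suc count)
  ... | no ¬seen = trans (cong₂ _+_ (numPal-∷-fresh T ¬seen) (γ-∷-fresh T ¬seen))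
                         (trans (+-suc (numPal T w) (length (γ T w))) (cong suc count))

  RichCount-factor : ∀ w → Factor u w → RichCount T w
  RichCount-factor []      _    = RichCount-[] T
  RichCount-factor (x ∷ w) fx∷w =
    RichCount-∷ fx∷w (RichCount-factor w (Factor-FactorOf fx∷w ([ x ] , [] , cong (x ∷_) (sym (++-identityʳ w)))))

  rich : ∀ {w} → Factor u w → Rich T w
  rich fw = RichCount⇒Rich T (RichCount-factor _ fw)

module _ {a} {A : Set a} where

  applyUpTo-cong : ∀ {f g : ℕ → A} → (∀ i → f i ≡ g i) → ∀ n → applyUpTo f n ≡ applyUpTo g n
  applyUpTo-cong f≗g zero    = refl
  applyUpTo-cong f≗g (suc n) = cong₂ _∷_ (f≗g 0) (applyUpTo-cong (f≗g ∘ suc) n)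

  applyUpTo-prefix : ∀ (f : ℕ → A) v s → v ++ s ≡ applyUpTo f (length (v ++ s)) → v ≡ applyUpTo f (length v)
  applyUpTo-prefix f []      s eq = refl
  applyUpTo-prefix f (x ∷ v) s eq = cong₂ _∷_ (∷-injectiveˡ eq) (applyUpTo-prefix (f ∘ suc) v s (∷-injectiveʳ eq))

  applyUpTo-infix : ∀ (f : ℕ → A) p v s → p ++ v ++ s ≡ applyUpTo f (length (p ++ v ++ s)) →
                    v ≡ applyUpTo (f ∘ (length p +_)) (length v)
  applyUpTo-infix f []      v s eq = applyUpTo-prefix f v s eq
  applyUpTo-infix f (_ ∷ p) v s eq = applyUpTo-infix (f ∘ suc) p v s (∷-injectiveʳ eq)

finite-infix : ∀ {k} (u p v s : Word k) → Factor (finite u) (p ++ v ++ s) → Factor (finite u) v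
finite-infix u p v s (p₀ , s₀ , u≡) = p₀ ++ p , s ++ s₀ , (begin
  u                             ≡⟨ u≡ ⟩
  p₀ ++ (p ++ v ++ s) ++ s₀     ≡⟨ cong (p₀ ++_) (++-assoc p (v ++ s) s₀) ⟩
  p₀ ++ p ++ (v ++ s) ++ s₀     ≡⟨ cong (λ z → p₀ ++ p ++ z) (++-assoc v s s₀) ⟩
  p₀ ++ p ++ v ++ s ++ s₀       ≡⟨ sym (++-assoc p₀ p _) ⟩
  (p₀ ++ p) ++ v ++ s ++ s₀     ∎)
  where open ≡-Reasoning

infinite-infix : ∀ {k} (f : ℕ → Fin k) (p v s : Word k) → Factor (infinite f) (p ++ v ++ s) → Factor (infinite f) v
infinite-infix f p v s (i , pvs≡) = i + length p , (begin
  v                                                  ≡⟨ applyUpTo-infix (λ j → f (i + j)) p v s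
                                                          (trans pvs≡ (map-applyUpTo id (λ j → f (i + j)) _)) ⟩
  applyUpTo (λ j → f (i + (length p + j))) (length v) ≡⟨ applyUpTo-cong (λ j → cong f (sym (+-assoc i (length p) j))) _ ⟩
  applyUpTo (λ j → f (i + length p + j)) (length v)   ≡⟨ sym (map-applyUpTo id (λ j → f (i + length p + j)) _) ⟩
  map (λ j → f (i + length p + j)) (upTo (length v)) ∎)
  where open ≡-Reasoning

proposition4p6 : (k : ℕ) (T : InvAntimorphism k) (u : InfOrFin k) →
    Cond1 T u → Cond2 T u → Cond3 T u → RichWord T u
proposition4p6 k T (finite u)   c1 c2 c3 = Richness.rich T (finite u) (finite-infix u) c1 c2 c3 ([] , [] , sym (++-identityʳ u))
proposition4p6 k T (infinite f) c1 c2 c3 = λ w → Richness.rich T (infinite f) (infinite-infix f) c1 c2 c3
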